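{- Let $(C_0,C_1)$ be an equitable $2$-partition of the halved $n$-cube $\frac12 H(n)$ with quotient matrix $\begin{pmatrix} a & b\\ c & d\end{pmatrix}$, such that $C_0$ is a linear code (a linear subspace of $\mathrm{GF}(2)^n$ consisting of even-weight words). Then for any positive integer $t<2^{n-1}/|C_0|$, taking $D_0$ to be the union of any $t$ distinct cosets of $C_0$ contained in the vertex set of $\frac12 H(n)$ and $D_1$ its complement, $(D_0,D_1)$ is an equitable partition of $\frac12 H(n)$ with quotient matrix $\begin{pmatrix} a+(t-1)c & b-(t-1)c\\ tc & d-(t-1)c\end{pmatrix}$.
   Context: The halved $n$-cube $\frac12 H(n)$ is the graph on the binary words of length $n$ with an even number of ones (viewed as vectors over GF$(2)$), two words adjacent iff they differ in exactly two positions; it has $2^{n-1}$ vertices and degree $n(n-1)/2$. An equitable $2$-partition is an ordered partition $(C_0,C_1)$ of the vertex set such that the number of neighbors in $C_j$ of any vertex of $C_i$ is a constant $S_{ij}$; $S=(S_{ij})$ is the quotient matrix. -}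

module Defs where

open import Data.Bool using (Bool; true; false; _∧_; not; _xor_; if_then_else_)
open import Data.Nat using (ℕ; zero; suc; _+_; _≡ᵇ_)
open import Data.Integer using (ℤ)
open import Data.Fin using (Fin; zero; suc)
open import Data.Vec using (Vec; []; _∷_; zipWith; replicate)
open import Data.List using (List; []; _∷_; _++_; map; allFin)
open import Data.Bool.ListAction using (any)
open import Data.Product using (Σ; _×_)
open import Relation.Binary.PropositionalEquality using (_≡_)

-- Binary words of length n (vectors over GF(2), true = 1).
Word : ℕ → Set
Word n = Vec Bool n

_⊕_ : ∀ {n} → Word n → Word n → Word n
u ⊕ v = zipWith _xor_ u v

zeroWord : ∀ n → Word n
zeroWord n = replicate n false

weight : ∀ {n} → Word n → ℕ
weight [] = 0
weight (true ∷ v) = suc (weight v)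
weight (false ∷ v) = weight v

isEven : ∀ {n} → Word n → Bool
isEven [] = true
isEven (b ∷ v) = if b then not (isEven v) else isEven v

dist : ∀ {n} → Word n → Word n → ℕ
dist u v = weight (u ⊕ v)

allWords : ∀ n → List (Word n)
allWords zero = [] ∷ []
allWords (suc n) = map (false ∷_) (allWords n) ++ map (true ∷_) (allWords n)

countL : ∀ {A : Set} → (A → Bool) → List A → ℕ
countL p [] = 0
countL p (x ∷ xs) = if p x then suc (countL p xs) else countL p xs

-- Adjacency in the halved n-cube: both even, differing in exactly two positions.
adjH : ∀ {n} → Word n → Word n → Bool
adjH u v = isEven u ∧ isEven v ∧ (dist u v ≡ᵇ 2)

-- A 2-partition (C₀,C₁) of the vertex set of ½H(n) is given by the
-- characteristic function C of C₀ (only its values on even words matter);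
-- C₁ is the set of even words not in C₀.
part : ∀ {n} → (Word n → Bool) → Fin 2 → Word n → Bool
part C zero v = isEven v ∧ C v
part C (suc zero) v = isEven v ∧ not (C v)

nbrs : ∀ {n} → (Word n → Bool) → Fin 2 → Word n → ℕ
nbrs {n} C j u = countL (λ v → adjH u v ∧ part C j v) (allWords n)

IsEquitable : ∀ n → (Word n → Bool) → (Fin 2 → Fin 2 → ℤ) → Set
IsEquitable n C S =
  (∀ i → Σ (Word n) (λ v → part C i v ≡ true)) ×
  (∀ i j (u : Word n) → part C i u ≡ true → ℤ.pos (nbrs C j u) ≡ S i j)

mat2 : ℤ → ℤ → ℤ → ℤ → Fin 2 → Fin 2 → ℤ
mat2 a b c d zero zero = a
mat2 a b c d zero (suc zero) = b
mat2 a b c d (suc zero) zero = c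
mat2 a b c d (suc zero) (suc zero) = d

IsLinearEvenCode : ∀ n → (Word n → Bool) → Set
IsLinearEvenCode n C =
  (∀ v → C v ≡ true → isEven v ≡ true) ×
  (C (zeroWord n) ≡ true) ×
  (∀ u v → C u ≡ true → C v ≡ true → C (u ⊕ v) ≡ true)

size : ∀ {n} → (Word n → Bool) → ℕ
size {n} C = countL C (allWords n)

unionCosets : ∀ {n t} → (Word n → Bool) → (Fin t → Word n) → Word n → Bool
unionCosets {t = t} C x v = any (λ i → C (v ⊕ x i)) (allFin t)

-- Translation by an even word is an automorphism of ½H(n), so a vertex u has
-- as many neighbours in the coset xᵢ + C as u + xᵢ has in C; by the quotient
-- matrix of (C₀,C₁) that is a if u ∈ xᵢ + C and c otherwise.  The cosets are
-- disjoint, so a vertex of ½H(n) has t c + [u ∈ D₀] (a − c) neighbours in D₀,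
-- and the graph is regular of degree a + b = c + d, which gives the second
-- column.  D₁ is nonempty because |D₀| = t |C₀| < 2ⁿ⁻¹.
module Submission where

open import Defs
open import Data.Bool using (Bool; true; false; _∧_; _∨_; not; _xor_; if_then_else_)
open import Data.Bool.ListAction using (any)
open import Data.Bool.Properties
  using (∧-conicalˡ; ∧-conicalʳ; ∧-zeroʳ; ∧-identityʳ; not-involutive; not-injective;
         not-distribˡ-xor; not-distribʳ-xor; xor-assoc; xor-comm; xor-identityʳ; xor-same)
open import Data.Fin using (Fin; zero; suc; fromℕ<; _≟_)
open import Data.Fin.Properties using (suc-injective)
open import Data.Integer using (ℤ; _+_; _-_; _*_)
open import Data.Integer.Properties using (pos-+)
open import Data.Integer.Tactic.RingSolver using (solve-∀)
open import Data.List using ([]; _∷_; _++_; map; length; tabulate)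
open import Data.List.Properties using (length-++; length-map)
open import Data.Nat using (ℕ; zero; suc; _<_; _≤_; _^_; _∸_)
import Data.Nat as N
open import Data.Nat.Properties using (+-0-monoid; +-comm; +-suc; +-identityʳ; +-cancelˡ-<)
open import Algebra.Properties.Monoid.Sum +-0-monoid using (sum; sum-cong-≗)
open import Data.Product using (Σ; _,_; proj₁; proj₂)
open import Data.Vec using ([]; _∷_)
open import Data.Vec.Properties using (zipWith-assoc; zipWith-comm; zipWith-identityʳ)
open import Function using (_∘_; id; case_of_)
open import Relation.Binary.PropositionalEquality
open import Relation.Nullary using (yes; no)

countL-cong : ∀ {A : Set} {p q : A → Bool} → (∀ x → p x ≡ q x) → ∀ xs → countL p xs ≡ countL q xs
countL-cong p≗q []                     = refl
countL-cong {q = q} p≗q (x ∷ xs) rewrite p≗q x =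
  cong (λ k → if q x then suc k else k) (countL-cong p≗q xs)

countL-none : ∀ {A : Set} {p : A → Bool} → (∀ x → p x ≡ false) → ∀ xs → countL p xs ≡ 0
countL-none p≗false []                 = refl
countL-none p≗false (x ∷ xs) rewrite p≗false x = countL-none p≗false xs

countL-++ : ∀ {A : Set} (p : A → Bool) xs ys → countL p (xs ++ ys) ≡ countL p xs N.+ countL p ys
countL-++ p []       ys = refl
countL-++ p (x ∷ xs) ys with p x
... | true  = cong suc (countL-++ p xs ys)
... | false = countL-++ p xs ys

countL-map : ∀ {A B : Set} (p : B → Bool) (f : A → B) xs → countL p (map f xs) ≡ countL (p ∘ f) xs
countL-map p f []       = refl
countL-map p f (x ∷ xs) = cong (λ k → if p (f x) then suc k else k) (countL-map p f xs)

countL-∧-∨ : ∀ {A : Set} (r f g : A → Bool) → (∀ x → f x ∧ g x ≡ false) → ∀ xs →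
  countL (λ x → r x ∧ (f x ∨ g x)) xs ≡ countL (λ x → r x ∧ f x) xs N.+ countL (λ x → r x ∧ g x) xs
countL-∧-∨ r f g disjoint []       = refl
countL-∧-∨ r f g disjoint (x ∷ xs) with r x | f x | g x | disjoint x
... | false | _     | _     | _  = countL-∧-∨ r f g disjoint xs
... | true  | true  | true  | ()
... | true  | true  | false | _  = cong suc (countL-∧-∨ r f g disjoint xs)
... | true  | false | true  | _  = trans (cong suc (countL-∧-∨ r f g disjoint xs)) (sym (+-suc _ _))
... | true  | false | false | _  = countL-∧-∨ r f g disjoint xs

countL-+-countL-not : ∀ {A : Set} (p : A → Bool) xs → countL p xs N.+ countL (not ∘ p) xs ≡ length xs
countL-+-countL-not p []       = refl
countL-+-countL-not p (x ∷ xs) with p x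
... | true  = cong suc (countL-+-countL-not p xs)
... | false = trans (+-suc _ _) (cong suc (countL-+-countL-not p xs))

0<countL⇒witness : ∀ {A : Set} (p : A → Bool) xs → 0 < countL p xs → Σ A (λ x → p x ≡ true)
0<countL⇒witness p (x ∷ xs) 0<count with p x in px
... | true  = x , px
... | false = 0<countL⇒witness p xs 0<count

anyFin : ∀ {t} → (Fin t → Bool) → Bool
anyFin {zero}  f = false
anyFin {suc t} f = f zero ∨ anyFin (f ∘ suc)

countFin : ∀ {t} → (Fin t → Bool) → ℕ
countFin g = sum (λ i → if g i then 1 else 0)

AtMostOne : ∀ {t} → (Fin t → Bool) → Set
AtMostOne g = ∀ {i j} → g i ≡ true → g j ≡ true → i ≡ j

any-tabulate : ∀ {A : Set} {t} (p : A → Bool) (g : Fin t → A) → any p (tabulate g) ≡ anyFin (p ∘ g)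
any-tabulate {t = zero}  p g = refl
any-tabulate {t = suc t} p g = cong (p (g zero) ∨_) (any-tabulate p (g ∘ suc))

∧-anyFin : ∀ {t} b (f : Fin t → Bool) → b ∧ anyFin f ≡ anyFin (λ i → b ∧ f i)
∧-anyFin {zero}  b     f = ∧-zeroʳ b
∧-anyFin {suc t} false f = ∧-anyFin false (f ∘ suc)
∧-anyFin {suc t} true  f = refl

anyFin-true : ∀ {t} (f : Fin t → Bool) i → f i ≡ true → anyFin f ≡ true
anyFin-true f zero    fi rewrite fi = refl
anyFin-true f (suc i) fi with f zero
... | true  = refl
... | false = anyFin-true (f ∘ suc) i fi

anyFin-false : ∀ {t} (f : Fin t → Bool) → (∀ i → f i ≡ false) → anyFin f ≡ false
anyFin-false {zero}  f f≗false = refl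
anyFin-false {suc t} f f≗false rewrite f≗false zero = anyFin-false (f ∘ suc) (f≗false ∘ suc)

AtMostOne-∧ˡ : ∀ {t} b {g : Fin t → Bool} → AtMostOne g → AtMostOne (λ i → b ∧ g i)
AtMostOne-∧ˡ b g≤1 bgi bgj = g≤1 (∧-conicalʳ b _ bgi) (∧-conicalʳ b _ bgj)

AtMostOne-tail : ∀ {t} {g : Fin (suc t) → Bool} → AtMostOne g → AtMostOne (g ∘ suc)
AtMostOne-tail g≤1 gi gj = suc-injective (g≤1 gi gj)

AtMostOne-head : ∀ {t} {g : Fin (suc t) → Bool} → AtMostOne g → g zero ≡ true → anyFin (g ∘ suc) ≡ false
AtMostOne-head {g = g} g≤1 g₀ = anyFin-false (g ∘ suc) g₀⇒gᵢ≡false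
  where
  g₀⇒gᵢ≡false : ∀ i → g (suc i) ≡ false
  g₀⇒gᵢ≡false i with g (suc i) in gᵢ
  ... | true  = case g≤1 g₀ gᵢ of λ ()
  ... | false = refl

countFin-atMostOne : ∀ {t} {g : Fin t → Bool} → AtMostOne g → countFin g ≡ (if anyFin g then 1 else 0)
countFin-atMostOne {zero}          g≤1 = refl
countFin-atMostOne {suc t} {g} g≤1 with g zero in g₀
... | true  = cong suc (trans (countFin-atMostOne (AtMostOne-tail g≤1))
                              (cong (if_then 1 else 0) (AtMostOne-head g≤1 g₀)))
... | false = countFin-atMostOne (AtMostOne-tail g≤1)

sum-const : ∀ t k → sum {t} (λ _ → k) ≡ t N.* k
sum-const zero    k = refl
sum-const (suc t) k = cong (k N.+_) (sum-const t k)

sum-select : ∀ {t} (f : Fin t → ℕ) (g : Fin t → Bool) (a c : ℤ) →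
  (∀ i → ℤ.pos (f i) ≡ (if g i then a else c)) →
  ℤ.pos (sum f) ≡ ℤ.pos t * c + ℤ.pos (countFin g) * (a - c)
sum-select {zero}  f g a c f≡ = refl
sum-select {suc t} f g a c f≡ = begin
  ℤ.pos (f zero N.+ sum (f ∘ suc))                       ≡⟨ pos-+ (f zero) _ ⟩
  ℤ.pos (f zero) + ℤ.pos (sum (f ∘ suc))                 ≡⟨ cong₂ _+_ (f≡ zero) (sum-select (f ∘ suc) (g ∘ suc) a c (f≡ ∘ suc)) ⟩
  (if g zero then a else c) + (ℤ.pos t * c + ℤ.pos K * (a - c)) ≡⟨ head-term (g zero) ⟩
  ℤ.pos (suc t) * c + ℤ.pos (countFin g) * (a - c)       ∎
  where
  open ≡-Reasoning
  K = countFin (g ∘ suc)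
  head-term : ∀ b → (if b then a else c) + (ℤ.pos t * c + ℤ.pos K * (a - c)) ≡
    ℤ.pos (suc t) * c + ℤ.pos ((if b then 1 else 0) N.+ K) * (a - c)
  head-term true  = in-coset a c (ℤ.pos t) (ℤ.pos K)
    where
    in-coset : ∀ a c T K → a + (T * c + K * (a - c)) ≡ (ℤ.pos 1 + T) * c + (ℤ.pos 1 + K) * (a - c)
    in-coset = solve-∀
  head-term false = off-coset a c (ℤ.pos t) (ℤ.pos K)
    where
    off-coset : ∀ a c T K → c + (T * c + K * (a - c)) ≡ (ℤ.pos 1 + T) * c + K * (a - c)
    off-coset = solve-∀

countL-∧-anyFin : ∀ {A : Set} {t} (r : A → Bool) (B : Fin t → A → Bool) →
  (∀ x → AtMostOne (λ i → B i x)) → ∀ xs →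
  countL (λ x → r x ∧ anyFin (λ i → B i x)) xs ≡ sum (λ i → countL (λ x → r x ∧ B i x) xs)
countL-∧-anyFin {t = zero}  r B B≤1 xs = countL-none (λ x → ∧-zeroʳ (r x)) xs
countL-∧-anyFin {t = suc t} r B B≤1 xs =
  trans (countL-∧-∨ r (B zero) (λ x → anyFin (λ i → B (suc i) x)) disjoint xs)
        (cong (countL (λ x → r x ∧ B zero x) xs N.+_)
              (countL-∧-anyFin r (B ∘ suc) (AtMostOne-tail ∘ B≤1) xs))
  where
  disjoint : ∀ x → B zero x ∧ anyFin (λ i → B (suc i) x) ≡ false
  disjoint x with B zero x in B₀x
  ... | true  = AtMostOne-head (B≤1 x) B₀x
  ... | false = refl

⊕-assoc : ∀ {n} (u v w : Word n) → (u ⊕ v) ⊕ w ≡ u ⊕ (v ⊕ w)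
⊕-assoc = zipWith-assoc xor-assoc

⊕-comm : ∀ {n} (u v : Word n) → u ⊕ v ≡ v ⊕ u
⊕-comm = zipWith-comm xor-comm

⊕-identityʳ : ∀ {n} (u : Word n) → u ⊕ zeroWord n ≡ u
⊕-identityʳ = zipWith-identityʳ xor-identityʳ

⊕-self : ∀ {n} (u : Word n) → u ⊕ u ≡ zeroWord n
⊕-self []      = refl
⊕-self (a ∷ u) = cong₂ _∷_ (xor-same a) (⊕-self u)

⊕-cancelʳ : ∀ {n} (v w : Word n) → (v ⊕ w) ⊕ w ≡ v
⊕-cancelʳ v w = begin
  (v ⊕ w) ⊕ w       ≡⟨ ⊕-assoc v w w ⟩
  v ⊕ (w ⊕ w)       ≡⟨ cong (v ⊕_) (⊕-self w) ⟩
  v ⊕ zeroWord _    ≡⟨ ⊕-identityʳ v ⟩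
  v                 ∎
  where open ≡-Reasoning

⊕-difference : ∀ {n} (v x y : Word n) → (v ⊕ x) ⊕ (v ⊕ y) ≡ x ⊕ y
⊕-difference v x y = begin
  (v ⊕ x) ⊕ (v ⊕ y)   ≡⟨ sym (⊕-assoc (v ⊕ x) v y) ⟩
  ((v ⊕ x) ⊕ v) ⊕ y   ≡⟨ cong (λ z → (z ⊕ v) ⊕ y) (⊕-comm v x) ⟩
  ((x ⊕ v) ⊕ v) ⊕ y   ≡⟨ cong (_⊕ y) (⊕-cancelʳ x v) ⟩
  x ⊕ y               ∎
  where open ≡-Reasoning

⊕-swap : ∀ {n} (u v w : Word n) → u ⊕ (v ⊕ w) ≡ (u ⊕ w) ⊕ v
⊕-swap u v w = trans (cong (u ⊕_) (⊕-comm v w)) (sym (⊕-assoc u w v))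

xor-not-not : ∀ x y → not x xor not y ≡ x xor y
xor-not-not false y = not-involutive y
xor-not-not true  y = refl

isEven-⊕ : ∀ {n} (u v : Word n) → isEven (u ⊕ v) ≡ not (isEven u xor isEven v)
isEven-⊕ []          []          = refl
isEven-⊕ (false ∷ u) (false ∷ v) = isEven-⊕ u v
isEven-⊕ (false ∷ u) (true ∷ v)  = cong not (trans (isEven-⊕ u v) (not-distribʳ-xor (isEven u) (isEven v)))
isEven-⊕ (true ∷ u)  (false ∷ v) = cong not (trans (isEven-⊕ u v) (not-distribˡ-xor (isEven u) (isEven v)))
isEven-⊕ (true ∷ u)  (true ∷ v)  = trans (isEven-⊕ u v) (cong not (sym (xor-not-not (isEven u) (isEven v))))

isEven-⊕-even : ∀ {n} (v w : Word n) → isEven w ≡ true → isEven (v ⊕ w) ≡ isEven v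
isEven-⊕-even v w w-even = begin
  isEven (v ⊕ w)                  ≡⟨ isEven-⊕ v w ⟩
  not (isEven v xor isEven w)     ≡⟨ cong (λ b → not (isEven v xor b)) w-even ⟩
  not (isEven v xor true)         ≡⟨ cong not (xor-comm (isEven v) true) ⟩
  not (not (isEven v))            ≡⟨ not-involutive (isEven v) ⟩
  isEven v                        ∎
  where open ≡-Reasoning

adjH-⊕ : ∀ {n} (u v w : Word n) → isEven w ≡ true → adjH u (v ⊕ w) ≡ adjH (u ⊕ w) v
adjH-⊕ u v w w-even
  rewrite isEven-⊕-even v w w-even | isEven-⊕-even u w w-even | ⊕-swap u v w = refl

adjH-∧-isEven : ∀ {n} (u v : Word n) → adjH u v ∧ isEven v ≡ adjH u v
adjH-∧-isEven u v with isEven u | isEven v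
... | false | _     = refl
... | true  | false = refl
... | true  | true  = ∧-identityʳ _

part⇒isEven : ∀ {n} (P : Word n → Bool) i {v} → part P i v ≡ true → isEven v ≡ true
part⇒isEven P zero       = ∧-conicalˡ _ _
part⇒isEven P (suc zero) = ∧-conicalˡ _ _

part-cover : ∀ {n} (P : Word n → Bool) v → part P zero v ∨ part P (suc zero) v ≡ isEven v
part-cover P v with isEven v | P v
... | false | _     = refl
... | true  | false = refl
... | true  | true  = refl

part-disjoint : ∀ {n} (P : Word n → Bool) v → part P zero v ∧ part P (suc zero) v ≡ false
part-disjoint P v with isEven v | P v
... | false | _     = refl
... | true  | false = refl
... | true  | true  = refl

part-⊕ : ∀ {n} (P : Word n → Bool) (w : Word n) → isEven w ≡ true →
  ∀ j v → part (λ v → P (v ⊕ w)) j (v ⊕ w) ≡ part P j v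
part-⊕ P w w-even zero v =
  cong₂ _∧_ (isEven-⊕-even v w w-even) (cong P (⊕-cancelʳ v w))
part-⊕ P w w-even (suc zero) v =
  cong₂ _∧_ (isEven-⊕-even v w w-even) (cong (not ∘ P) (⊕-cancelʳ v w))

countL-allWords-suc : ∀ {n} (p : Word (suc n) → Bool) →
  countL p (allWords (suc n)) ≡ countL (λ v → p (false ∷ v)) (allWords n) N.+ countL (λ v → p (true ∷ v)) (allWords n)
countL-allWords-suc {n} p = trans (countL-++ p (map (false ∷_) (allWords n)) _) (cong₂ N._+_ (countL-map p _ (allWords n)) (countL-map p _ (allWords n)))

countL-allWords-⊕ : ∀ {n} (p : Word n → Bool) (w : Word n) →
  countL p (allWords n) ≡ countL (λ v → p (v ⊕ w)) (allWords n)
countL-allWords-⊕ p []            = refl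
countL-allWords-⊕ {suc n} p (b ∷ w) = begin
  countL p (allWords (suc n))
    ≡⟨ countL-allWords-suc p ⟩
  countL (λ v → p (false ∷ v)) ws N.+ countL (λ v → p (true ∷ v)) ws
    ≡⟨ cong₂ N._+_ (countL-allWords-⊕ (λ v → p (false ∷ v)) w) (countL-allWords-⊕ (λ v → p (true ∷ v)) w) ⟩
  countL (λ v → p (false ∷ (v ⊕ w))) ws N.+ countL (λ v → p (true ∷ (v ⊕ w))) ws
    ≡⟨ halves b ⟩
  countL (λ v → p ((false ∷ v) ⊕ (b ∷ w))) ws N.+ countL (λ v → p ((true ∷ v) ⊕ (b ∷ w))) ws
    ≡⟨ sym (countL-allWords-suc (λ v → p (v ⊕ (b ∷ w)))) ⟩
  countL (λ v → p (v ⊕ (b ∷ w))) (allWords (suc n))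
    ∎
  where
  open ≡-Reasoning
  ws = allWords n
  halves : ∀ b →
    countL (λ v → p (false ∷ (v ⊕ w))) ws N.+ countL (λ v → p (true ∷ (v ⊕ w))) ws ≡
    countL (λ v → p ((false ∷ v) ⊕ (b ∷ w))) ws N.+ countL (λ v → p ((true ∷ v) ⊕ (b ∷ w))) ws
  halves false = refl
  halves true  = +-comm (countL (λ v → p (false ∷ (v ⊕ w))) ws) _

length-allWords : ∀ n → length (allWords n) ≡ 2 ^ n
length-allWords zero    = refl
length-allWords (suc n) = begin
  length (map (false ∷_) ws ++ map (true ∷_) ws)          ≡⟨ length-++ (map (false ∷_) ws) ⟩
  length (map (false ∷_) ws) N.+ length (map (true ∷_) ws) ≡⟨ cong₂ N._+_ (length-map _ ws) (length-map _ ws) ⟩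
  length ws N.+ length ws                                  ≡⟨ cong₂ N._+_ (length-allWords n) (length-allWords n) ⟩
  2 ^ n N.+ 2 ^ n                                          ≡⟨ cong (2 ^ n N.+_) (sym (+-identityʳ (2 ^ n))) ⟩
  2 ^ suc n                                                ∎
  where
  open ≡-Reasoning
  ws = allWords n

countL-isEven-allWords : ∀ n → countL isEven (allWords n) ≡ 2 ^ (n ∸ 1)
countL-isEven-allWords zero    = refl
countL-isEven-allWords (suc n) =
  trans (countL-allWords-suc {n} isEven) (trans (countL-+-countL-not isEven (allWords n)) (length-allWords n))

countL-part-⊕ : ∀ {n} (P : Word n → Bool) (w : Word n) → isEven w ≡ true → ∀ j →
  countL (part (λ v → P (v ⊕ w)) j) (allWords n) ≡ countL (part P j) (allWords n)
countL-part-⊕ {n} P w w-even j =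
  trans (countL-allWords-⊕ (part (λ v → P (v ⊕ w)) j) w) (countL-cong (part-⊕ P w w-even j) (allWords n))

countL-isEven-part : ∀ {n} (P : Word n → Bool) →
  countL isEven (allWords n) ≡ countL (part P zero) (allWords n) N.+ countL (part P (suc zero)) (allWords n)
countL-isEven-part {n} P = trans (countL-cong (sym ∘ part-cover P) (allWords n))
  (countL-∧-∨ (λ _ → true) (part P zero) (part P (suc zero)) (part-disjoint P) (allWords n))

degree : ∀ {n} → Word n → ℕ
degree {n} u = countL (adjH u) (allWords n)

degree-even : ∀ {n} (u : Word n) → isEven u ≡ true → degree u ≡ degree (zeroWord n)
degree-even {n} u u-even = begin
  degree u                                    ≡⟨ countL-allWords-⊕ (adjH u) u ⟩
  countL (λ v → adjH u (v ⊕ u)) (allWords n)  ≡⟨ countL-cong (λ v → adjH-⊕ u v u u-even) (allWords n) ⟩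
  degree (u ⊕ u)                              ≡⟨ cong degree (⊕-self u) ⟩
  degree (zeroWord n)                         ∎
  where open ≡-Reasoning

nbrs-split : ∀ {n} (P : Word n → Bool) u → nbrs P zero u N.+ nbrs P (suc zero) u ≡ degree u
nbrs-split {n} P u = sym (trans
  (countL-cong (λ v → sym (trans (cong (adjH u v ∧_) (part-cover P v)) (adjH-∧-isEven u v))) (allWords n))
  (countL-∧-∨ (adjH u) (part P zero) (part P (suc zero)) (part-disjoint P) (allWords n)))

nbrs-⊕ : ∀ {n} (P : Word n → Bool) (w : Word n) → isEven w ≡ true →
  ∀ j u → nbrs (λ v → P (v ⊕ w)) j u ≡ nbrs P j (u ⊕ w)
nbrs-⊕ {n} P w w-even j u = trans (countL-allWords-⊕ (λ v → adjH u v ∧ part (λ v → P (v ⊕ w)) j v) w)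
  (countL-cong (λ v → cong₂ _∧_ (adjH-⊕ u v w w-even) (part-⊕ P w w-even j v)) (allWords n))

module _ {n} {P : Word n → Bool} {S : Fin 2 → Fin 2 → ℤ} (equitable : IsEquitable n P S) where

  degree-equitable : ∀ i → ℤ.pos (degree (zeroWord n)) ≡ S i zero + S i (suc zero)
  degree-equitable i = begin
    ℤ.pos (degree (zeroWord n))                            ≡⟨ cong ℤ.pos (sym (degree-even v (part⇒isEven P i v∈Pᵢ))) ⟩
    ℤ.pos (degree v)                                       ≡⟨ cong ℤ.pos (sym (nbrs-split P v)) ⟩
    ℤ.pos (nbrs P zero v N.+ nbrs P (suc zero) v)          ≡⟨ pos-+ (nbrs P zero v) _ ⟩
    ℤ.pos (nbrs P zero v) + ℤ.pos (nbrs P (suc zero) v)    ≡⟨ cong₂ _+_ (proj₂ equitable i zero v v∈Pᵢ) (proj₂ equitable i (suc zero) v v∈Pᵢ) ⟩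
    S i zero + S i (suc zero)                              ∎
    where
    open ≡-Reasoning
    v = proj₁ (proj₁ equitable i)
    v∈Pᵢ = proj₂ (proj₁ equitable i)

  nbrs₀-equitable : ∀ u → isEven u ≡ true → ℤ.pos (nbrs P zero u) ≡ (if P u then S zero zero else S (suc zero) zero)
  nbrs₀-equitable u u-even with P u in Pu
  ... | true  = proj₂ equitable zero zero u (cong₂ _∧_ u-even Pu)
  ... | false = proj₂ equitable (suc zero) zero u (cong₂ _∧_ u-even (cong not Pu))

nbrs₁≡degree-nbrs₀ : ∀ {n} (P : Word n → Bool) u → isEven u ≡ true →
  ℤ.pos (nbrs P (suc zero) u) ≡ ℤ.pos (degree (zeroWord n)) - ℤ.pos (nbrs P zero u)
nbrs₁≡degree-nbrs₀ {n} P u u-even = begin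
  ℤ.pos n₁                           ≡⟨ y≡x+y-x (ℤ.pos n₀) (ℤ.pos n₁) ⟩
  (ℤ.pos n₀ + ℤ.pos n₁) - ℤ.pos n₀   ≡⟨ cong (_- ℤ.pos n₀) (sym (pos-+ n₀ n₁)) ⟩
  ℤ.pos (n₀ N.+ n₁) - ℤ.pos n₀       ≡⟨ cong (λ k → ℤ.pos k - ℤ.pos n₀) (trans (nbrs-split P u) (degree-even u u-even)) ⟩
  ℤ.pos (degree (zeroWord n)) - ℤ.pos n₀ ∎
  where
  open ≡-Reasoning
  n₀ = nbrs P zero u
  n₁ = nbrs P (suc zero) u
  y≡x+y-x : ∀ x y → y ≡ (x + y) - x
  y≡x+y-x = solve-∀

module UnionOfCosets {n} (C : Word n → Bool) (code : IsLinearEvenCode n C)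
  {t} (x : Fin t → Word n) (x-even : ∀ i → isEven (x i) ≡ true)
  (x-inequivalent : ∀ i j → i ≢ j → C (x i ⊕ x j) ≡ false) where

  D : Word n → Bool
  D = unionCosets C x

  coset : Fin t → Word n → Bool
  coset i v = C (v ⊕ x i)

  cosets-disjoint : ∀ v → AtMostOne (λ i → coset i v)
  cosets-disjoint v {i} {j} v∈i v∈j with i ≟ j
  ... | yes i≡j = i≡j
  ... | no  i≢j = case trans (sym (x-inequivalent i j i≢j)) xᵢ⊕xⱼ∈C of λ ()
    where
    xᵢ⊕xⱼ∈C : C (x i ⊕ x j) ≡ true
    xᵢ⊕xⱼ∈C = subst (λ w → C w ≡ true) (⊕-difference v (x i) (x j)) (proj₂ (proj₂ code) _ _ v∈i v∈j)

  D≡anyFin : ∀ v → D v ≡ anyFin (λ i → coset i v)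
  D≡anyFin v = any-tabulate (λ i → coset i v) id

  part₀-D : ∀ v → part D zero v ≡ anyFin (λ i → part (coset i) zero v)
  part₀-D v = trans (cong (isEven v ∧_) (D≡anyFin v)) (∧-anyFin (isEven v) (λ i → coset i v))

  countL-∧-part₀-D : ∀ (r : Word n → Bool) →
    countL (λ v → r v ∧ part D zero v) (allWords n) ≡ sum (λ i → countL (λ v → r v ∧ part (coset i) zero v) (allWords n))
  countL-∧-part₀-D r = trans (countL-cong (λ v → cong (r v ∧_) (part₀-D v)) (allWords n))
    (countL-∧-anyFin r (λ i → part (coset i) zero) (λ v → AtMostOne-∧ˡ (isEven v) (cosets-disjoint v)) (allWords n))

  nbrs₀-D : ∀ u → nbrs D zero u ≡ sum (λ i → nbrs C zero (u ⊕ x i))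
  nbrs₀-D u = trans (countL-∧-part₀-D (adjH u)) (sum-cong-≗ (λ i → nbrs-⊕ C (x i) (x-even i) zero u))

  size-D : countL (part D zero) (allWords n) ≡ t N.* size C
  size-D = begin
    countL (part D zero) (allWords n)                      ≡⟨ countL-∧-part₀-D (λ _ → true) ⟩
    sum (λ i → countL (part (coset i) zero) (allWords n))  ≡⟨ sum-cong-≗ (λ i → countL-part-⊕ C (x i) (x-even i) zero) ⟩
    sum {t} (λ _ → countL (part C zero) (allWords n))      ≡⟨ sum-const t (countL (part C zero) (allWords n)) ⟩
    t N.* countL (part C zero) (allWords n)                ≡⟨ cong (t N.*_) (countL-cong code-even (allWords n)) ⟩
    t N.* size C                                           ∎
    where
    open ≡-Reasoning
    code-even : ∀ v → isEven v ∧ C v ≡ C v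
    code-even v with C v in Cv
    ... | true  = cong (_∧ true) (proj₁ code v Cv)
    ... | false = ∧-zeroʳ (isEven v)

  part₀-D-nonempty : 1 ≤ t → Σ (Word n) (λ v → part D zero v ≡ true)
  part₀-D-nonempty 1≤t = x i₀ , cong₂ _∧_ (x-even i₀) (trans (D≡anyFin (x i₀)) (anyFin-true _ i₀ x₀∈coset₀))
    where
    i₀ = fromℕ< 1≤t
    x₀∈coset₀ : coset i₀ (x i₀) ≡ true
    x₀∈coset₀ = trans (cong C (⊕-self (x i₀))) (proj₁ (proj₂ code))

  part₁-D-nonempty : t N.* size C < 2 ^ (n ∸ 1) → Σ (Word n) (λ v → part D (suc zero) v ≡ true)
  part₁-D-nonempty tC<2ⁿ⁻¹ = 0<countL⇒witness (part D (suc zero)) (allWords n)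
    (+-cancelˡ-< (t N.* size C) 0 _ (subst (_< t N.* size C N.+ count₁) (sym (+-identityʳ _)) tC<tC+count₁))
    where
    count₁ = countL (part D (suc zero)) (allWords n)
    tC<tC+count₁ : t N.* size C < t N.* size C N.+ count₁
    tC<tC+count₁ = subst (t N.* size C <_)
      (trans (sym (countL-isEven-allWords n)) (trans (countL-isEven-part D) (cong (N._+ count₁) size-D)))
      tC<2ⁿ⁻¹

  module Quotient (a b c d : ℤ) (C-equitable : IsEquitable n C (mat2 a b c d)) where

    nbrs₀-D-equitable : ∀ u → isEven u ≡ true →
      ℤ.pos (nbrs D zero u) ≡ ℤ.pos t * c + ℤ.pos (if D u then 1 else 0) * (a - c)
    nbrs₀-D-equitable u u-even = begin
      ℤ.pos (nbrs D zero u)                                       ≡⟨ cong ℤ.pos (nbrs₀-D u) ⟩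
      ℤ.pos (sum (λ i → nbrs C zero (u ⊕ x i)))                   ≡⟨ sum-select _ (λ i → coset i u) a c rows ⟩
      ℤ.pos t * c + ℤ.pos (countFin (λ i → coset i u)) * (a - c)  ≡⟨ cong (λ k → ℤ.pos t * c + ℤ.pos k * (a - c)) count≡ ⟩
      ℤ.pos t * c + ℤ.pos (if D u then 1 else 0) * (a - c)        ∎
      where
      open ≡-Reasoning
      rows : ∀ i → ℤ.pos (nbrs C zero (u ⊕ x i)) ≡ (if coset i u then a else c)
      rows i = nbrs₀-equitable C-equitable (u ⊕ x i) (trans (isEven-⊕-even u (x i) (x-even i)) u-even)
      count≡ : countFin (λ i → coset i u) ≡ (if D u then 1 else 0)
      count≡ = trans (countFin-atMostOne (cosets-disjoint u)) (cong (if_then 1 else 0) (sym (D≡anyFin u)))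

    nbrs₀-in-D₀ : ∀ u → part D zero u ≡ true → ℤ.pos (nbrs D zero u) ≡ a + (ℤ.pos t - ℤ.pos 1) * c
    nbrs₀-in-D₀ u u∈D₀ = trans (nbrs₀-D-equitable u (∧-conicalˡ _ _ u∈D₀))
      (trans (cong (λ b → ℤ.pos t * c + ℤ.pos (if b then 1 else 0) * (a - c)) (∧-conicalʳ (isEven u) (D u) u∈D₀))
             (simplify a c (ℤ.pos t)))
      where
      simplify : ∀ a c T → T * c + ℤ.pos 1 * (a - c) ≡ a + (T - ℤ.pos 1) * c
      simplify = solve-∀

    nbrs₀-in-D₁ : ∀ u → part D (suc zero) u ≡ true → ℤ.pos (nbrs D zero u) ≡ ℤ.pos t * c
    nbrs₀-in-D₁ u u∈D₁ = trans (nbrs₀-D-equitable u (∧-conicalˡ _ _ u∈D₁))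
      (trans (cong (λ b → ℤ.pos t * c + ℤ.pos (if b then 1 else 0) * (a - c)) (not-injective (∧-conicalʳ (isEven u) (not (D u)) u∈D₁)))
             (simplify a c (ℤ.pos t)))
      where
      simplify : ∀ a c T → T * c + ℤ.pos 0 * (a - c) ≡ T * c
      simplify = solve-∀

    D-quotient : ∀ i j u → part D i u ≡ true → ℤ.pos (nbrs D j u) ≡
      mat2 (a + (ℤ.pos t - ℤ.pos 1) * c) (b - (ℤ.pos t - ℤ.pos 1) * c)
           (ℤ.pos t * c) (d - (ℤ.pos t - ℤ.pos 1) * c) i j
    D-quotient zero zero u u∈D₀ = nbrs₀-in-D₀ u u∈D₀
    D-quotient (suc zero) zero u u∈D₁ = nbrs₀-in-D₁ u u∈D₁
    D-quotient zero (suc zero) u u∈D₀ = begin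
      ℤ.pos (nbrs D (suc zero) u)                                  ≡⟨ nbrs₁≡degree-nbrs₀ D u (∧-conicalˡ _ _ u∈D₀) ⟩
      ℤ.pos (degree (zeroWord n)) - ℤ.pos (nbrs D zero u)          ≡⟨ cong₂ _-_ (degree-equitable C-equitable zero) (nbrs₀-in-D₀ u u∈D₀) ⟩
      (a + b) - (a + (ℤ.pos t - ℤ.pos 1) * c)                      ≡⟨ simplify a b c (ℤ.pos t) ⟩
      b - (ℤ.pos t - ℤ.pos 1) * c                                  ∎
      where
      open ≡-Reasoning
      simplify : ∀ a b c T → (a + b) - (a + (T - ℤ.pos 1) * c) ≡ b - (T - ℤ.pos 1) * c
      simplify = solve-∀
    D-quotient (suc zero) (suc zero) u u∈D₁ = begin
      ℤ.pos (nbrs D (suc zero) u)                                  ≡⟨ nbrs₁≡degree-nbrs₀ D u (∧-conicalˡ _ _ u∈D₁) ⟩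
      ℤ.pos (degree (zeroWord n)) - ℤ.pos (nbrs D zero u)          ≡⟨ cong₂ _-_ (degree-equitable C-equitable (suc zero)) (nbrs₀-in-D₁ u u∈D₁) ⟩
      (c + d) - ℤ.pos t * c                                        ≡⟨ simplify c d (ℤ.pos t) ⟩
      d - (ℤ.pos t - ℤ.pos 1) * c                                  ∎
      where
      open ≡-Reasoning
      simplify : ∀ c d T → (c + d) - T * c ≡ d - (T - ℤ.pos 1) * c
      simplify = solve-∀

lemma2 : (n : ℕ) (C : Word n → Bool) (a b c d : ℤ) →
    IsEquitable n C (mat2 a b c d) →
    IsLinearEvenCode n C →
    (t : ℕ) → 1 ≤ t → t N.* size C < 2 ^ (n ∸ 1) →
    (x : Fin t → Word n) →
    (∀ i → isEven (x i) ≡ true) →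
    (∀ i j → i ≢ j → C (x i ⊕ x j) ≡ false) →
    IsEquitable n (unionCosets C x)
      (mat2 (a + (ℤ.pos t - ℤ.pos 1) * c) (b - (ℤ.pos t - ℤ.pos 1) * c)
            (ℤ.pos t * c) (d - (ℤ.pos t - ℤ.pos 1) * c))
lemma2 n C a b c d C-equitable code t 1≤t tC<2ⁿ⁻¹ x x-even x-inequivalent = nonempty , D-quotient
  where
  open UnionOfCosets C code x x-even x-inequivalent
  open Quotient a b c d C-equitable
  nonempty : ∀ i → Σ (Word n) (λ v → part D i v ≡ true)
  nonempty zero       = part₀-D-nonempty 1≤t
  nonempty (suc zero) = part₁-D-nonempty tC<2ⁿ⁻¹
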